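{- Let $\Lambda$ be a normal greedoid over a finite alphabet $\Sigma$ possessing an aligned polymatroid representation $\rho$, and let $x_1\cdots x_r\in\Lambda$ be a basic word. Then for every letter $y\in\Sigma$ there exist indices $j,k\in\{0,1,\dots,r\}$ with $j<k$ such that for every $i\in\{0,1,\dots,r\}$: $j\le i<k$ if and only if $y\in\Gamma[x_1\cdots x_i]$ (where $x_1\cdots x_0$ denotes the empty word).
   Context: Words: $\Sigma^*$ finite words over $\Sigma$; simple = no repeated letter; $\tilde\alpha$ the set of letters, $|\alpha|$ the length. A greedoid over $\Sigma$ is a nonempty language $\Lambda\subseteq\Sigma^*$ of simple words with (i) $\alpha\beta\in\Lambda\Rightarrow\alpha\in\Lambda$, (ii) if $\alpha,\beta\in\Lambda$, $|\alpha|>|\beta|$, then $\beta x\in\Lambda$ for some $x\in\tilde\alpha$. Basic words are feasible words of maximum length. Normal: every letter occurs in some word of $\Lambda$. Continuations $\Gamma[\alpha]=\{x:\alpha x\in\Lambda\}$; flats are classes of $\alpha\sim\beta\iff\Gamma[\alpha]=\Gamma[\beta]$, written $[\alpha]$, ordered by $[\alpha]\sqsubset[\beta]$ iff some nonempty $\beta'$ has $\alpha\beta'\in\Lambda$, $\alpha\beta'\sim\beta$; this poset is $\mathcal{L}_\Lambda$ with covering relation $\prec$. A polymatroid rank function is $\rho:2^\Sigma\to\mathbb{R}$, $\rho(\emptyset)=0$, monotone, submodular; span $\sigma_\rho(X)=\{y:\rho(X\cup\{y\})=\rho(X)\}$; $\mathcal{L}_\rho$ the lattice of closed sets ($X=\sigma_\rho(X)$)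 under inclusion. $\rho$ is a representation of $\Lambda$ if $\Lambda=\{x_1\cdots x_k:\rho(\{x_1,\dots,x_i\})=i\ \forall i\le k\}$. It is aligned if there is an order preserving $\varphi:\mathcal{L}_\Lambda\to\mathcal{L}_\rho$ ($F\sqsubset F'\Rightarrow\varphi(F)\subsetneq\varphi(F')$) with $\rho(\tilde\alpha)=\rho(\varphi[\alpha])$, $\tilde\alpha\subseteq\varphi[\alpha]$ for all $\alpha\in\Lambda$, and $F\prec F'\Rightarrow\varphi(F)\prec\varphi(F')$. -}

module Defs where

open import Data.Nat using (ℕ; zero; suc; _≤_; _<_)
open import Data.Fin using (Fin)
open import Data.Fin.Subset using (Subset; ⊥; ⁅_⁆; _∪_; _∩_; _⊆_; _⊂_)
open import Data.List using (List; []; _∷_; _++_; [_]; length; take)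
open import Data.List.Membership.Propositional using (_∈_)
open import Data.List.Relation.Unary.Unique.Propositional using (Unique)
open import Data.Product using (Σ; ∃; _×_; _,_)
open import Relation.Nullary using (¬_)
open import Relation.Binary.PropositionalEquality using (_≡_; _≢_)
open import Relation.Binary.Structures using (IsTotalOrder)
open import Algebra.Structures using (IsAbelianGroup)
open import Function.Bundles using (_⇔_)

-- Codomain of rank functions: an arbitrary totally ordered abelian group
-- with a distinguished positive element 1# (ℝ with its usual structure is
-- an instance; stdlib has no reals).
record OrderedAbelianGroup : Set₁ where
  infixl 6 _+_
  infix 4 _≤ᵍ_
  field
    Carrier        : Set
    _+_            : Carrier → Carrier → Carrier
    0#             : Carrier
    -_             : Carrier → Carrier
    1#             : Carrier
    _≤ᵍ_           : Carrier → Carrier → Set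
    isAbelianGroup : IsAbelianGroup _≡_ _+_ 0# -_
    isTotalOrder   : IsTotalOrder _≡_ _≤ᵍ_
    +-monoˡ-≤      : ∀ {x y} z → x ≤ᵍ y → x + z ≤ᵍ y + z
    0≤1            : 0# ≤ᵍ 1#
    0≢1            : 0# ≢ 1#

  ⟦_⟧ : ℕ → Carrier
  ⟦ zero ⟧  = 0#
  ⟦ suc i ⟧ = 1# + ⟦ i ⟧

module _ {n : ℕ} where

  Word : Set
  Word = List (Fin n)

  Language : Set₁
  Language = Word → Set

  letters : Word → Subset n
  letters []      = ⊥
  letters (x ∷ α) = ⁅ x ⁆ ∪ letters α

  record IsGreedoid (Λ : Language) : Set where
    field
      nonempty : ∃ λ α → Λ α
      simple   : ∀ α → Λ α → Unique α
      hereditary : ∀ α β → Λ (α ++ β) → Λ α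
      exchange : ∀ α β → Λ α → Λ β → length β < length α →
                 Σ (Fin n) λ x → x ∈ α × Λ (β ++ [ x ])

  IsNormal : Language → Set
  IsNormal Λ = ∀ (x : Fin n) → ∃ λ α → Λ α × x ∈ α

  IsBasic : Language → Word → Set
  IsBasic Λ α = Λ α × (∀ β → Λ β → length β ≤ length α)

  Γ : Language → Word → Fin n → Set
  Γ Λ α x = Λ (α ++ [ x ])

  _∼[_]_ : Word → Language → Word → Set
  α ∼[ Λ ] β = ∀ x → Γ Λ α x ⇔ Γ Λ β x

  _⊏[_]_ : Word → Language → Word → Set
  α ⊏[ Λ ] β = Σ Word λ β' → (β' ≢ []) × Λ (α ++ β') × ((α ++ β') ∼[ Λ ] β)

  -- covering relation in the poset of flats (flats = classes of feasible words)
  _≺[_]_ : Word → Language → Word → Set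
  α ≺[ Λ ] β = (α ⊏[ Λ ] β) ×
               ¬ (Σ Word λ γ → Λ γ × (α ⊏[ Λ ] γ) × (γ ⊏[ Λ ] β))

  module _ (G : OrderedAbelianGroup) where
    open OrderedAbelianGroup G

    record IsPolymatroid (ρ : Subset n → Carrier) : Set where
      field
        empty      : ρ ⊥ ≡ 0#
        monotone   : ∀ X Y → X ⊆ Y → ρ X ≤ᵍ ρ Y
        submodular : ∀ X Y → ρ (X ∪ Y) + ρ (X ∩ Y) ≤ᵍ ρ X + ρ Y

    IsClosed : (Subset n → Carrier) → Subset n → Set
    IsClosed ρ X = ∀ y → (y Data.Fin.Subset.∈ X) ⇔ (ρ (X ∪ ⁅ y ⁆) ≡ ρ X)

    _⋖[_]_ : Subset n → (Subset n → Carrier) → Subset n → Set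
    X ⋖[ ρ ] Y = (X ⊂ Y) ×
                 ¬ (Σ (Subset n) λ Z → IsClosed ρ Z × (X ⊂ Z) × (Z ⊂ Y))

    IsRepresentation : (Subset n → Carrier) → Language → Set
    IsRepresentation ρ Λ =
      ∀ α → Λ α ⇔ (∀ i → i ≤ length α → ρ (letters (take i α)) ≡ ⟦ i ⟧)

    -- φ : L_Λ → L_ρ given on feasible representatives, constant on ∼-classes
    record IsAligned (ρ : Subset n → Carrier) (Λ : Language) : Set where
      field
        φ            : Word → Subset n
        well-defined : ∀ α β → Λ α → Λ β → α ∼[ Λ ] β → φ α ≡ φ β
        closed       : ∀ α → Λ α → IsClosed ρ (φ α)
        strict-mono  : ∀ α β → Λ α → Λ β → α ⊏[ Λ ] β → φ α ⊂ φ β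
        rank-eq      : ∀ α → Λ α → ρ (letters α) ≡ ρ (φ α)
        letters-⊆    : ∀ α → Λ α → letters α ⊆ φ α
        covers       : ∀ α β → Λ α → Λ β → α ≺[ Λ ] β → φ α ⋖[ ρ ] φ β

    record AlignedPolymatroidRep (Λ : Language) : Set where
      field
        ρ              : Subset n → Carrier
        isPolymatroid  : IsPolymatroid ρ
        representation : IsRepresentation ρ Λ
        aligned        : IsAligned ρ Λ

-- Write ω_i = x₁⋯x_i and A_i = {x₁,…,x_i}. Through the representation,
-- y ∈ Γ[ω_i] iff ρ(A_i ∪ {y}) = i + 1, and y ∈ φ[ω_i] rules this out.
-- Now y ∉ φ[ε], because y continues some feasible word P and φ[ε] ⊆ φ[P];
-- and y ∈ φ[ω], because every feasible word containing y extends to a basic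
-- word, and all basic words have the same flat. So there is a first p + 1
-- with y ∈ φ[ω_{p+1}]. Since φ[ω_p] ⋖ φ[ω_{p+1}] is a cover of closed sets,
-- the closure of φ[ω_p] ∪ {y} is φ[ω_{p+1}], hence ρ(φ[ω_p] ∪ {y}) ≥ p + 1.
-- Submodularity, in the form "the marginal rank of y shrinks as the set
-- grows", turns this into ρ(A_i ∪ {y}) ≥ i + 1 for every i ≤ p (with
-- equality at i = p), and transports equality at j to equality at every
-- i ∈ [j, p]. So y ∈ Γ[ω_i] holds exactly from the least such j up to p.
{-# OPTIONS --safe #-}
module Submission where

open import Defs
open import Data.Nat using (ℕ; _≤_; _<_)
open import Data.Fin using (Fin)
open import Data.List using (length; take)
open import Data.Product using (Σ; ∃; _×_)
open import Function.Bundles using (_⇔_)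

open import Data.Nat as ℕ using (zero; suc; z≤n; s≤s; s≤s⁻¹; _∸_)
open import Data.Nat.Properties
  using (≤-refl; ≤-reflexive; ≤-trans; <⇒≤; <⇒≱; <-irrefl; ≮⇒≥; <-cmp; m<n⇒m<1+n; m<1+n⇒m<n∨m≡n;
         m≤n⇒m<n∨m≡n; m<m+n; m+[n∸m]≡n; +-suc; +-identityʳ; n≤1+n; m≤n⇒m⊓n≡m)
open import Data.Bool.Properties using (T-≡)
open import Data.Fin.Subset
  using (Subset; ⁅_⁆; _∪_; _∩_; _⊆_; _⊂_) renaming (_∈_ to _∈ₛ_; _∉_ to _∉ₛ_)
open import Data.Fin.Subset.Properties
  using (_∈?_; ⊆-refl; ⊆-trans; ⊆-antisym; p⊆p∪q; q⊆p∪q; x∈p∪q⁻; x∈p∩q⁺; x∈⁅x⁆; x∈⁅y⁆⇒x≡y;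
         ∪-assoc; ∪-identityˡ; ∪-identityʳ)
open import Data.List using (List; []; _∷_; _++_; [_]; drop; filter; allFin)
open import Data.List.Properties
  using (length-++; length-take; take-take; take++drop≡id; take-all; ++-identityʳ; ++-assoc)
open import Data.List.Membership.Propositional using (_∈_; _∉_)
open import Data.List.Membership.Propositional.Properties using (∈-∃++; ∈-++⁺ʳ; ∈-filter⁺; ∈-allFin)
open import Data.List.Relation.Unary.Any using (here; there)
open import Data.List.Relation.Unary.All using (All; []; _∷_; lookup)
open import Data.List.Relation.Unary.All.Properties using (all-filter)
open import Data.List.Relation.Unary.AllPairs using (_∷_)
open import Data.List.Relation.Unary.Unique.Propositional using (Unique)
open import Data.Product using (_,_; proj₁; proj₂)
open import Data.Sum using (_⊎_; inj₁; inj₂; [_,_]′)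
open import Data.Empty using (⊥-elim)
open import Data.Vec as Vec using (tabulate)
open import Data.Vec.Properties using ([]=⇒lookup; lookup⇒[]=; lookup∘tabulate)
open import Function using (id; _∘_)
open import Function.Bundles using (mk⇔; module Equivalence)
open import Relation.Nullary using (¬_; yes; no; contradiction)
open import Relation.Nullary.Decidable using (isYes; toWitness; fromWitness)
open import Relation.Unary using (Decidable)
open import Relation.Binary.Definitions using (DecidableEquality; tri<; tri≈; tri>)
open import Relation.Binary.Structures using (IsTotalOrder)
open import Relation.Binary.Bundles using (Poset)
import Relation.Binary.Reasoning.PartialOrder as ≤-Reasoning
open import Relation.Binary.PropositionalEquality
  using (_≡_; _≢_; refl; sym; trans; cong; cong₂; subst; subst₂; module ≡-Reasoning)
open import Algebra.Structures using (IsAbelianGroup)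

open Equivalence using (to; from)

module _ {P : ℕ → Set} where

  IsLeast : ℕ → Set
  IsLeast j = P j × (∀ i → i < j → ¬ P i)

module _ {P : ℕ → Set} (P? : Decidable P) where

  least-below : ∀ m → (∃ λ j → j < m × IsLeast {P} j) ⊎ (∀ i → i < m → ¬ P i)
  least-below zero = inj₂ λ _ ()
  least-below (suc m) with least-below m
  ... | inj₁ (j , j<m , least) = inj₁ (j , m<n⇒m<1+n j<m , least)
  ... | inj₂ none with P? m
  ...   | yes Pm = inj₁ (m , ≤-refl , Pm , none)
  ...   | no ¬Pm = inj₂ λ i i<1+m → [ none i , (λ { refl → ¬Pm }) ]′ (m<1+n⇒m<n∨m≡n i<1+m)

  least : ∀ {m} → P m → ∃ λ j → j ≤ m × IsLeast {P} j
  least {m} Pm with least-below (suc m)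
  ... | inj₁ (j , j<1+m , least) = j , s≤s⁻¹ j<1+m , least
  ... | inj₂ none = ⊥-elim (none m ≤-refl Pm)

module OrderedAbelianGroupProperties (G : OrderedAbelianGroup) where
  open OrderedAbelianGroup G
  open IsAbelianGroup isAbelianGroup using (assoc; comm; identityˡ; identityʳ; inverseʳ)
  open IsTotalOrder isTotalOrder public using (antisym; total)
    renaming (trans to ≤ᵍ-trans; reflexive to ≤ᵍ-reflexive)

  +-monoʳ-≤ : ∀ z {x y} → x ≤ᵍ y → z + x ≤ᵍ z + y
  +-monoʳ-≤ z {x} {y} x≤y = subst₂ _≤ᵍ_ (comm x z) (comm y z) (+-monoˡ-≤ z x≤y)

  +-mono-≤ : ∀ {x y u v} → x ≤ᵍ y → u ≤ᵍ v → x + u ≤ᵍ y + v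
  +-mono-≤ {y = y} {u} x≤y u≤v = ≤ᵍ-trans (+-monoˡ-≤ u x≤y) (+-monoʳ-≤ y u≤v)

  +-cancelʳ-≤ : ∀ z {x y} → x + z ≤ᵍ y + z → x ≤ᵍ y
  +-cancelʳ-≤ z {x} {y} le = subst₂ _≤ᵍ_ (+z-z x) (+z-z y) (+-monoˡ-≤ (- z) le)
    where
    +z-z : ∀ w → w + z + - z ≡ w
    +z-z w = trans (assoc w z (- z)) (trans (cong (w +_) (inverseʳ z)) (identityʳ w))

  +-cancelˡ-≤ : ∀ z {x y} → z + x ≤ᵍ z + y → x ≤ᵍ y
  +-cancelˡ-≤ z {x} {y} le = +-cancelʳ-≤ z (subst₂ _≤ᵍ_ (comm z x) (comm z y) le)

  1+x≰x : ∀ x → ¬ (1# + x ≤ᵍ x)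
  1+x≰x x le = 0≢1 (antisym 0≤1 (+-cancelʳ-≤ x (subst (1# + x ≤ᵍ_) (sym (identityˡ x)) le)))

  ≤ᵍ-poset : Poset _ _ _
  ≤ᵍ-poset = record { isPartialOrder = IsTotalOrder.isPartialOrder isTotalOrder }

  ⟦+⟧ : ∀ a b → ⟦ a ℕ.+ b ⟧ ≡ ⟦ a ⟧ + ⟦ b ⟧
  ⟦+⟧ zero    b = sym (identityˡ ⟦ b ⟧)
  ⟦+⟧ (suc a) b = trans (cong (1# +_) (⟦+⟧ a b)) (sym (assoc 1# ⟦ a ⟧ ⟦ b ⟧))

  ⟦suc⟧-exchange : ∀ a b → ⟦ suc a ⟧ + ⟦ b ⟧ ≡ ⟦ a ⟧ + ⟦ suc b ⟧
  ⟦suc⟧-exchange a b = begin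
    ⟦ suc a ⟧ + ⟦ b ⟧    ≡⟨ ⟦+⟧ (suc a) b ⟨
    ⟦ suc (a ℕ.+ b) ⟧    ≡⟨ cong ⟦_⟧ (+-suc a b) ⟨
    ⟦ a ℕ.+ suc b ⟧      ≡⟨ ⟦+⟧ a (suc b) ⟩
    ⟦ a ⟧ + ⟦ suc b ⟧    ∎
    where open ≡-Reasoning

  -- Totality alone decides equality: if x ≡ y, then total x y and total y x are
  -- the same term, so they cannot land on different sides.
  _≟_ : DecidableEquality Carrier
  x ≟ y with total x y in xy | total y x in yx
  ... | inj₁ x≤y | inj₁ y≤x = yes (antisym x≤y y≤x)
  ... | inj₂ y≤x | inj₂ x≤y = yes (antisym x≤y y≤x)
  ... | inj₁ _   | inj₂ _   = no λ { refl → contradiction (trans (sym xy) yx) λ () }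
  ... | inj₂ _   | inj₁ _   = no λ { refl → contradiction (trans (sym yx) xy) λ () }

module _ {A : Set} where

  take≤-++ : ∀ {i j} (xs : List A) → i ≤ j → take i xs ++ drop i (take j xs) ≡ take j xs
  take≤-++ {i} {j} xs i≤j = begin
    take i xs ++ rest           ≡⟨ cong (λ k → take k xs ++ rest) (m≤n⇒m⊓n≡m i≤j) ⟨
    take (i ℕ.⊓ j) xs ++ rest   ≡⟨ cong (_++ rest) (take-take i j xs) ⟨
    take i (take j xs) ++ rest  ≡⟨ take++drop≡id i (take j xs) ⟩
    take j xs                   ∎
    where
    open ≡-Reasoning
    rest = drop i (take j xs)

  take-++ˡ : ∀ {i} (xs ys : List A) → i ≤ length xs → take i (xs ++ ys) ≡ take i xs
  take-++ˡ {zero}  xs       ys _         = refl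
  take-++ˡ {suc i} (x ∷ xs) ys (s≤s i≤n) = cong (x ∷_) (take-++ˡ xs ys i≤n)

  length-take≤ : ∀ {i} (xs : List A) → i ≤ length xs → length (take i xs) ≡ i
  length-take≤ {i} xs i≤n = trans (length-take i xs) (m≤n⇒m⊓n≡m i≤n)

  length-snoc : (xs : List A) (x : A) → length (xs ++ [ x ]) ≡ suc (length xs)
  length-snoc []       x = refl
  length-snoc (_ ∷ xs) x = cong suc (length-snoc xs x)

  length<⇒≢[] : (xs ys : List A) → length xs < length (xs ++ ys) → ys ≢ []
  length<⇒≢[] xs ys lt refl = <-irrefl (sym (cong length (++-identityʳ xs))) lt

  Unique-snoc⇒∉ : (xs : List A) {x : A} → Unique (xs ++ [ x ]) → x ∉ xs
  Unique-snoc⇒∉ (_ ∷ xs) (x≢ ∷ _)   (here refl) = lookup x≢ (∈-++⁺ʳ xs (here refl)) refl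
  Unique-snoc⇒∉ (_ ∷ xs) (_  ∷ uniq) (there x∈xs) = Unique-snoc⇒∉ xs uniq x∈xs

module _ {n : ℕ} where

  ∪-lub : {p q r : Subset n} → p ⊆ r → q ⊆ r → p ∪ q ⊆ r
  ∪-lub {p} {q} p⊆r q⊆r x∈p∪q = [ p⊆r , q⊆r ]′ (x∈p∪q⁻ p q x∈p∪q)

  ⊆-∩ : {p q r : Subset n} → r ⊆ p → r ⊆ q → r ⊆ p ∩ q
  ⊆-∩ r⊆p r⊆q x∈r = x∈p∩q⁺ (r⊆p x∈r , r⊆q x∈r)

  ⁅x⁆⊆ : {x : Fin n} {p : Subset n} → x ∈ₛ p → ⁅ x ⁆ ⊆ p
  ⁅x⁆⊆ {x} {p} x∈p y∈⁅x⁆ = subst (_∈ₛ p) (sym (x∈⁅y⁆⇒x≡y x y∈⁅x⁆)) x∈p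

  subsetOf : {P : Fin n → Set} → Decidable P → Subset n
  subsetOf P? = tabulate (isYes ∘ P?)

  ∈-subsetOf : {P : Fin n → Set} (P? : Decidable P) {x : Fin n} → x ∈ₛ subsetOf P? ⇔ P x
  ∈-subsetOf P? {x} = mk⇔
    (λ x∈ → toWitness {a? = P? x} (from T-≡ (trans (sym lookup-x) ([]=⇒lookup x∈))))
    (λ Px → lookup⇒[]= x _ (trans lookup-x (to T-≡ (fromWitness {a? = P? x} Px))))
    where
    lookup-x : Vec.lookup (subsetOf P?) x ≡ isYes (P? x)
    lookup-x = lookup∘tabulate (isYes ∘ P?) x

  ∈⇒∈letters : {x : Fin n} {α : Word} → x ∈ α → x ∈ₛ letters α
  ∈⇒∈letters {α = x ∷ _} (here refl) = p⊆p∪q _ (x∈⁅x⁆ x)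
  ∈⇒∈letters {α = x ∷ _} (there x∈α) = q⊆p∪q ⁅ x ⁆ _ (∈⇒∈letters x∈α)

  letters-++ : (α β : Word {n}) → letters (α ++ β) ≡ letters α ∪ letters β
  letters-++ []      β = sym (∪-identityˡ (letters β))
  letters-++ (x ∷ α) β =
    trans (cong (⁅ x ⁆ ∪_) (letters-++ α β)) (sym (∪-assoc ⁅ x ⁆ (letters α) (letters β)))

  letters-snoc : (α : Word {n}) (z : Fin n) → letters (α ++ [ z ]) ≡ letters α ∪ ⁅ z ⁆
  letters-snoc α z = trans (letters-++ α [ z ]) (cong (letters α ∪_) (∪-identityʳ ⁅ z ⁆))

  letters-take-mono : ∀ {i j} (α : Word {n}) → i ≤ j → letters (take i α) ⊆ letters (take j α)
  letters-take-mono {i = i} {j} α i≤j =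
    subst (letters (take i α) ⊆_)
      (trans (sym (letters-++ (take i α) _)) (cong letters (take≤-++ α i≤j)))
      (p⊆p∪q _)

module PolymatroidProperties {n : ℕ} (G : OrderedAbelianGroup)
  {ρ : Subset n → OrderedAbelianGroup.Carrier G} (poly : IsPolymatroid G ρ) where
  open OrderedAbelianGroup G
  open OrderedAbelianGroupProperties G
  open IsPolymatroid poly
  open ≤-Reasoning ≤ᵍ-poset

  diminishing-returns : ∀ {X Y} z → X ⊆ Y → ρ (Y ∪ ⁅ z ⁆) + ρ X ≤ᵍ ρ Y + ρ (X ∪ ⁅ z ⁆)
  diminishing-returns {X} {Y} z X⊆Y = ≤ᵍ-trans
    (+-mono-≤ (monotone _ _ (∪-lub (p⊆p∪q _) (⊆-trans (q⊆p∪q X ⁅ z ⁆) (q⊆p∪q Y _))))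
              (monotone _ _ (⊆-∩ X⊆Y (p⊆p∪q ⁅ z ⁆))))
    (submodular Y (X ∪ ⁅ z ⁆))

  ρ-∪-⁅∈⁆ : ∀ {X z} → z ∈ₛ X → ρ (X ∪ ⁅ z ⁆) ≡ ρ X
  ρ-∪-⁅∈⁆ z∈X = cong ρ (⊆-antisym (∪-lub ⊆-refl (⁅x⁆⊆ z∈X)) (p⊆p∪q _))

  ρ-∪-letters≤ : ∀ {X} ws → All (λ w → ρ (X ∪ ⁅ w ⁆) ≡ ρ X) ws → ρ (X ∪ letters ws) ≤ᵍ ρ X
  ρ-∪-letters≤ {X} []       []                         = ≤ᵍ-reflexive (cong ρ (∪-identityʳ X))
  ρ-∪-letters≤ {X} (w ∷ ws) (w-spanned ∷ ws-spanned) = +-cancelʳ-≤ (ρ X) (begin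
    ρ (X ∪ (⁅ w ⁆ ∪ letters ws)) + ρ X  ≤⟨ +-monoˡ-≤ (ρ X) (monotone _ _ regroup) ⟩
    ρ (Y ∪ ⁅ w ⁆) + ρ X                ≤⟨ diminishing-returns w (p⊆p∪q (letters ws)) ⟩
    ρ Y + ρ (X ∪ ⁅ w ⁆)                ≡⟨ cong (ρ Y +_) w-spanned ⟩
    ρ Y + ρ X                          ≤⟨ +-monoˡ-≤ (ρ X) (ρ-∪-letters≤ ws ws-spanned) ⟩
    ρ X + ρ X                          ∎)
    where
    Y : Subset n
    Y = X ∪ letters ws
    regroup : X ∪ (⁅ w ⁆ ∪ letters ws) ⊆ Y ∪ ⁅ w ⁆
    regroup = ∪-lub (⊆-trans (p⊆p∪q _) (p⊆p∪q _))
                    (∪-lub (q⊆p∪q Y _) (⊆-trans (q⊆p∪q X _) (p⊆p∪q _)))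

  span : Subset n → Subset n
  span X = subsetOf (λ z → ρ (X ∪ ⁅ z ⁆) ≟ ρ X)

  ∈-span : ∀ {X z} → z ∈ₛ span X ⇔ ρ (X ∪ ⁅ z ⁆) ≡ ρ X
  ∈-span {X} = ∈-subsetOf (λ z → ρ (X ∪ ⁅ z ⁆) ≟ ρ X)

  ⊆-span : ∀ {X} → X ⊆ span X
  ⊆-span z∈X = from ∈-span (ρ-∪-⁅∈⁆ z∈X)

  ρ-span≤ : ∀ {X} → ρ (span X) ≤ᵍ ρ X
  ρ-span≤ {X} = ≤ᵍ-trans (monotone _ _ span⊆) (ρ-∪-letters≤ spanned (all-filter spanned? (allFin n)))
    where
    spanned? = λ z → ρ (X ∪ ⁅ z ⁆) ≟ ρ X
    spanned = filter spanned? (allFin n)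
    span⊆ : span X ⊆ X ∪ letters spanned
    span⊆ {z} z∈ = q⊆p∪q X _ (∈⇒∈letters (∈-filter⁺ spanned? (∈-allFin z) (to ∈-span z∈)))

  span-closed : ∀ {X} → IsClosed G ρ (span X)
  span-closed {X} w = mk⇔ ρ-∪-⁅∈⁆ λ w-spanned → from ∈-span (antisym
    (begin
      ρ (X ∪ ⁅ w ⁆)       ≤⟨ monotone _ _ (∪-lub (⊆-trans ⊆-span (p⊆p∪q _)) (q⊆p∪q _ _)) ⟩
      ρ (span X ∪ ⁅ w ⁆)  ≡⟨ w-spanned ⟩
      ρ (span X)          ≤⟨ ρ-span≤ ⟩
      ρ X                 ∎)
    (monotone _ _ (p⊆p∪q _)))

  span-least : ∀ {X Y} → X ⊆ Y → IsClosed G ρ Y → span X ⊆ Y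
  span-least {X} {Y} X⊆Y Y-closed {z} z∈ = from (Y-closed z) (antisym
    (+-cancelʳ-≤ (ρ X) (begin
      ρ (Y ∪ ⁅ z ⁆) + ρ X  ≤⟨ diminishing-returns z X⊆Y ⟩
      ρ Y + ρ (X ∪ ⁅ z ⁆)  ≡⟨ cong (ρ Y +_) (to ∈-span z∈) ⟩
      ρ Y + ρ X            ∎))
    (monotone _ _ (p⊆p∪q _)))

  ρ-cover≤ : ∀ {X Y z} → IsClosed G ρ Y → _⋖[_]_ G X ρ Y → z ∈ₛ Y → z ∉ₛ X →
             ρ Y ≤ᵍ ρ (X ∪ ⁅ z ⁆)
  ρ-cover≤ {X} {Y} {z} Y-closed (X⊂Y , nothing-between) z∈Y z∉X =
    ≤ᵍ-trans (monotone _ _ Y⊆Z) ρ-span≤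
    where
    Z : Subset n
    Z = span (X ∪ ⁅ z ⁆)
    X⊂Z : X ⊂ Z
    X⊂Z = ⊆-trans (p⊆p∪q _) ⊆-span , z , ⊆-span (q⊆p∪q X _ (x∈⁅x⁆ z)) , z∉X
    Z⊆Y : Z ⊆ Y
    Z⊆Y = span-least (∪-lub (proj₁ X⊂Y) (⁅x⁆⊆ z∈Y)) Y-closed
    Y⊆Z : Y ⊆ Z
    Y⊆Z {w} w∈Y with w ∈? Z
    ... | yes w∈Z = w∈Z
    ... | no  w∉Z = ⊥-elim (nothing-between (Z , span-closed , X⊂Z , Z⊆Y , w , w∈Y , w∉Z))

module RepresentationProperties {n : ℕ} (G : OrderedAbelianGroup)
  (ρ : Subset n → OrderedAbelianGroup.Carrier G) (Λ : Language {n})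
  (rep : IsRepresentation G ρ Λ) where
  open OrderedAbelianGroup G

  rank-letters : ∀ {α} → Λ α → ρ (letters α) ≡ ⟦ length α ⟧
  rank-letters {α} Λα = subst (λ β → ρ (letters β) ≡ ⟦ length α ⟧) (take-all (length α) α ≤-refl)
    (to (rep α) Λα (length α) ≤-refl)

  Γ⇔rank : ∀ {α z} → Λ α → Γ Λ α z ⇔ ρ (letters α ∪ ⁅ z ⁆) ≡ ⟦ suc (length α) ⟧
  Γ⇔rank {α} {z} Λα = mk⇔ rank-of-extension extension-of-rank
    where
    open ≡-Reasoning
    rank-of-extension : Λ (α ++ [ z ]) → ρ (letters α ∪ ⁅ z ⁆) ≡ ⟦ suc (length α) ⟧
    rank-of-extension Λαz = begin
      ρ (letters α ∪ ⁅ z ⁆)       ≡⟨ cong ρ (letters-snoc α z) ⟨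
      ρ (letters (α ++ [ z ]))    ≡⟨ rank-letters Λαz ⟩
      ⟦ length (α ++ [ z ]) ⟧     ≡⟨ cong ⟦_⟧ (length-snoc α z) ⟩
      ⟦ suc (length α) ⟧          ∎
    extension-of-rank : ρ (letters α ∪ ⁅ z ⁆) ≡ ⟦ suc (length α) ⟧ → Λ (α ++ [ z ])
    extension-of-rank ρ-αz = from (rep (α ++ [ z ])) prefix-rank
      where
      prefix-rank : ∀ i → i ≤ length (α ++ [ z ]) → ρ (letters (take i (α ++ [ z ]))) ≡ ⟦ i ⟧
      prefix-rank i i≤ with m≤n⇒m<n∨m≡n (subst (i ≤_) (length-snoc α z) i≤)
      ... | inj₁ (s≤s i≤n) = subst (λ β → ρ (letters β) ≡ ⟦ i ⟧) (sym (take-++ˡ α [ z ] i≤n))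
                               (to (rep α) Λα i i≤n)
      ... | inj₂ refl = begin
        ρ (letters (take i (α ++ [ z ])))
          ≡⟨ cong (ρ ∘ letters) (take-all i (α ++ [ z ]) (≤-reflexive (length-snoc α z))) ⟩
        ρ (letters (α ++ [ z ]))           ≡⟨ cong ρ (letters-snoc α z) ⟩
        ρ (letters α ∪ ⁅ z ⁆)              ≡⟨ ρ-αz ⟩
        ⟦ suc (length α) ⟧                 ∎

module GreedoidProperties {n : ℕ} {Λ : Language {n}} (gr : IsGreedoid Λ) where
  open IsGreedoid gr

  Λ[] : Λ []
  Λ[] = let α , Λα = nonempty in hereditary [] α Λα

  Λ-take : ∀ {α} i → Λ α → Λ (take i α)
  Λ-take {α} i Λα = hereditary (take i α) (drop i α) (subst Λ (sym (take++drop≡id i α)) Λα)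

  Γ⊆⇒≮ : ∀ {α β} → Λ α → Λ β → (∀ x → Γ Λ α x → Γ Λ β x) → ¬ length α < length β
  Γ⊆⇒≮ {α} {β} Λα Λβ Γα⊆Γβ lt with exchange β α Λβ Λα lt
  ... | x , x∈β , Λαx = Unique-snoc⇒∉ β (simple _ (Γα⊆Γβ x Λαx)) x∈β

  ∼⇒length≡ : ∀ {α β} → Λ α → Λ β → α ∼[ Λ ] β → length α ≡ length β
  ∼⇒length≡ {α} {β} Λα Λβ α∼β with <-cmp (length α) (length β)
  ... | tri< lt _ _ = ⊥-elim (Γ⊆⇒≮ Λα Λβ (λ x → to (α∼β x)) lt)
  ... | tri≈ _ eq _ = eq
  ... | tri> _ _ gt = ⊥-elim (Γ⊆⇒≮ Λβ Λα (λ x → from (α∼β x)) gt)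

  ⊏⇒length< : ∀ {α β} → Λ β → α ⊏[ Λ ] β → length α < length β
  ⊏⇒length< {α} Λβ ([] , []≢[] , _) = ⊥-elim ([]≢[] refl)
  ⊏⇒length< {α} Λβ (b ∷ β' , _ , Λαβ' , αβ'∼β) =
    subst (length α <_) (trans (sym (length-++ α)) (∼⇒length≡ Λαβ' Λβ αβ'∼β))
          (m<m+n (length α) (s≤s z≤n))

  ⊏-++ : ∀ {α β} → Λ (α ++ β) → β ≢ [] → α ⊏[ Λ ] (α ++ β)
  ⊏-++ Λαβ β≢[] = _ , β≢[] , Λαβ , λ _ → mk⇔ id id

  take-⊏ : ∀ {α i j} → Λ α → i < j → j ≤ length α → take i α ⊏[ Λ ] take j α
  take-⊏ {α} {i} {j} Λα i<j j≤n =
    subst (take i α ⊏[ Λ ]_) split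
          (⊏-++ (subst Λ (sym split) (Λ-take j Λα)) (length<⇒≢[] (take i α) _ longer))
    where
    split : take i α ++ drop i (take j α) ≡ take j α
    split = take≤-++ α (<⇒≤ i<j)
    longer : length (take i α) < length (take i α ++ drop i (take j α))
    longer = subst₂ _<_ (sym (length-take≤ α (≤-trans (<⇒≤ i<j) j≤n)))
                        (sym (trans (cong length split) (length-take≤ α j≤n))) i<j

  take-≺ : ∀ {α p} → Λ α → suc p ≤ length α → take p α ≺[ Λ ] take (suc p) α
  take-≺ {α} {p} Λα 1+p≤n = take-⊏ Λα ≤-refl 1+p≤n , λ (γ , Λγ , p⊏γ , γ⊏1+p) →
    <⇒≱ (subst (_< length γ) (length-take≤ α (≤-trans (n≤1+n p) 1+p≤n)) (⊏⇒length< Λγ p⊏γ))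
        (s≤s⁻¹ (subst (length γ <_) (length-take≤ α 1+p≤n) (⊏⇒length< (Λ-take (suc p) Λα) γ⊏1+p)))

  extend-to-length : ∀ {β ω} d → Λ ω → Λ β → length β ℕ.+ d ≡ length ω →
           ∃ λ δ → Λ δ × length δ ≡ length ω × letters β ⊆ letters δ
  extend-to-length {β} zero    Λω Λβ len = β , Λβ , trans (sym (+-identityʳ _)) len , id
  extend-to-length {β} {ω} (suc d) Λω Λβ len
    with exchange ω β Λω Λβ (subst (length β <_) len (m<m+n _ (s≤s z≤n)))
  ... | x , _ , Λβx
    with extend-to-length d Λω Λβx (trans (cong (ℕ._+ d) (length-snoc β x)) (trans (sym (+-suc _ d)) len))
  ...   | δ , Λδ , lenδ , βx⊆δ = δ , Λδ , lenδ ,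
          ⊆-trans (subst (letters β ⊆_) (sym (letters-++ β [ x ])) (p⊆p∪q _)) βx⊆δ

  module _ {ω} (ω-basic : IsBasic Λ ω) where

    ¬Γ-of-basic-length : ∀ {α x} → length α ≡ length ω → ¬ Γ Λ α x
    ¬Γ-of-basic-length {α} {x} len Λαx =
      <⇒≱ ≤-refl (subst (_≤ length ω) (trans (length-snoc α x) (cong suc len)) (proj₂ ω-basic _ Λαx))

    ∼-basic : ∀ {α} → length α ≡ length ω → α ∼[ Λ ] ω
    ∼-basic len x = mk⇔ (⊥-elim ∘ ¬Γ-of-basic-length len) (⊥-elim ∘ ¬Γ-of-basic-length refl)

module AlignedRepresentationProperties {n : ℕ} {Λ : Language {n}} (gr : IsGreedoid Λ)
  (G : OrderedAbelianGroup) (R : AlignedPolymatroidRep G Λ) where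
  open IsGreedoid gr using (hereditary)
  open OrderedAbelianGroup G
  open OrderedAbelianGroupProperties G
  open AlignedPolymatroidRep R
  open IsPolymatroid isPolymatroid using (monotone)
  open IsAligned aligned
  open PolymatroidProperties G isPolymatroid
  open RepresentationProperties G ρ Λ representation
  open GreedoidProperties gr
  open ≤-Reasoning ≤ᵍ-poset

  rank-φ : ∀ {α} → Λ α → ρ (φ α) ≡ ⟦ length α ⟧
  rank-φ {α} Λα = trans (sym (rank-eq α Λα)) (rank-letters Λα)

  ∈φ⇒¬Γ : ∀ {α z} → Λ α → z ∈ₛ φ α → ¬ Γ Λ α z
  ∈φ⇒¬Γ {α} {z} Λα z∈φα Λαz = 1+x≰x ⟦ length α ⟧ (begin
    ⟦ suc (length α) ⟧     ≡⟨ to (Γ⇔rank Λα) Λαz ⟨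
    ρ (letters α ∪ ⁅ z ⁆)  ≤⟨ monotone _ _ (∪-lub (letters-⊆ α Λα) (⁅x⁆⊆ z∈φα)) ⟩
    ρ (φ α)                ≡⟨ rank-φ Λα ⟩
    ⟦ length α ⟧           ∎)

  φ[]⊆φ : ∀ {α} → Λ α → φ [] ⊆ φ α
  φ[]⊆φ {[]}    _  = id
  φ[]⊆φ {x ∷ α} Λα = proj₁ (strict-mono [] (x ∷ α) Λ[] Λα (⊏-++ Λα λ ()))

  ∉φ[] : ∀ {y β} → Λ β → y ∈ β → y ∉ₛ φ []
  ∉φ[] {y} Λβ y∈β y∈φ[] with ∈-∃++ y∈β
  ... | P , Q , refl = ∈φ⇒¬Γ ΛP (φ[]⊆φ ΛP y∈φ[]) ΛPy
    where
    ΛPy : Λ (P ++ [ y ])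
    ΛPy = hereditary (P ++ [ y ]) Q (subst Λ (sym (++-assoc P [ y ] Q)) Λβ)
    ΛP : Λ P
    ΛP = hereditary P [ y ] ΛPy

  φ-take-mono : ∀ {ω i j} → Λ ω → i ≤ j → j ≤ length ω → φ (take i ω) ⊆ φ (take j ω)
  φ-take-mono {ω} {i} {j} Λω i≤j j≤n with m≤n⇒m<n∨m≡n i≤j
  ... | inj₁ i<j = proj₁ (strict-mono _ _ (Λ-take i Λω) (Λ-take j Λω) (take-⊏ Λω i<j j≤n))
  ... | inj₂ refl = id

  ∈φ-basic : ∀ {ω y β} → IsBasic Λ ω → Λ β → y ∈ β → y ∈ₛ φ ω
  ∈φ-basic {ω} {y} {β} ω-basic@(Λω , maximal) Λβ y∈β
    with extend-to-length (length ω ∸ length β) Λω Λβ (m+[n∸m]≡n (maximal β Λβ))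
  ... | δ , Λδ , lenδ , β⊆δ = subst (y ∈ₛ_) (well-defined δ ω Λδ Λω (∼-basic ω-basic lenδ))
                                (letters-⊆ δ Λδ (β⊆δ (∈⇒∈letters y∈β)))

  first-flat-containing : ∀ {ω} → IsNormal Λ → IsBasic Λ ω → ∀ y →
    ∃ λ p → suc p ≤ length ω × y ∉ₛ φ (take p ω) × y ∈ₛ φ (take (suc p) ω)
  first-flat-containing {ω} normal ω-basic y with normal y
  ... | β , Λβ , y∈β with least (λ i → y ∈? φ (take i ω))
                         (subst (λ α → y ∈ₛ φ α) (sym (take-all _ ω ≤-refl)) (∈φ-basic ω-basic Λβ y∈β))
  ...   | zero  , _     , y∈φ[] , _     = ⊥-elim (∉φ[] Λβ y∈β y∈φ[])
  ...   | suc p , 1+p≤n , y∈    , below = p , 1+p≤n , below p ≤-refl , y∈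

  module _ {ω} (Λω : Λ ω) (y : Fin n) where

    A : ℕ → Subset n
    A i = letters (take i ω)

    -- Unlike the continuation predicate, this is decidable, which the search
    -- for the least j needs.
    RankRises : ℕ → Set
    RankRises i = ρ (A i ∪ ⁅ y ⁆) ≡ ⟦ suc i ⟧

    rankRises? : Decidable RankRises
    rankRises? i = ρ (A i ∪ ⁅ y ⁆) ≟ ⟦ suc i ⟧

    Γ⇔RankRises : ∀ {i} → i ≤ length ω → Γ Λ (take i ω) y ⇔ RankRises i
    Γ⇔RankRises {i} i≤n = subst (λ k → Γ Λ (take i ω) y ⇔ (ρ (A i ∪ ⁅ y ⁆) ≡ ⟦ suc k ⟧))
      (length-take≤ ω i≤n) (Γ⇔rank (Λ-take i Λω))

    rank-take : ∀ {i} → i ≤ length ω → ρ (A i) ≡ ⟦ i ⟧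
    rank-take {i} i≤n = trans (rank-letters (Λ-take i Λω)) (cong ⟦_⟧ (length-take≤ ω i≤n))

    rank-φ-take : ∀ {i} → i ≤ length ω → ρ (φ (take i ω)) ≡ ⟦ i ⟧
    rank-φ-take {i} i≤n = trans (sym (rank-eq _ (Λ-take i Λω))) (rank-take i≤n)

    RankRises-upper : ∀ {i j} → j ≤ i → i ≤ length ω → RankRises j →
                      ρ (A i ∪ ⁅ y ⁆) ≤ᵍ ⟦ suc i ⟧
    RankRises-upper {i} {j} j≤i i≤n rises-j = +-cancelʳ-≤ ⟦ j ⟧ (begin
      ρ (A i ∪ ⁅ y ⁆) + ⟦ j ⟧    ≡⟨ cong (_ +_) (rank-take (≤-trans j≤i i≤n)) ⟨
      ρ (A i ∪ ⁅ y ⁆) + ρ (A j)  ≤⟨ diminishing-returns y (letters-take-mono ω j≤i) ⟩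
      ρ (A i) + ρ (A j ∪ ⁅ y ⁆)  ≡⟨ cong₂ _+_ (rank-take i≤n) rises-j ⟩
      ⟦ i ⟧ + ⟦ suc j ⟧          ≡⟨ ⟦suc⟧-exchange i j ⟨
      ⟦ suc i ⟧ + ⟦ j ⟧          ∎)

    module _ {p} (1+p≤n : suc p ≤ length ω)
             (y∉φp : y ∉ₛ φ (take p ω)) (y∈φ1+p : y ∈ₛ φ (take (suc p) ω)) where

      p≤n : p ≤ length ω
      p≤n = ≤-trans (n≤1+n p) 1+p≤n

      rank-φp∪y : ⟦ suc p ⟧ ≤ᵍ ρ (φ (take p ω) ∪ ⁅ y ⁆)
      rank-φp∪y = subst (_≤ᵍ _) (rank-φ-take 1+p≤n)
        (ρ-cover≤ (closed _ (Λ-take (suc p) Λω))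
                  (covers _ _ (Λ-take p Λω) (Λ-take (suc p) Λω) (take-≺ Λω 1+p≤n)) y∈φ1+p y∉φp)

      RankRises-lower : ∀ {i} → i ≤ p → ⟦ suc i ⟧ ≤ᵍ ρ (A i ∪ ⁅ y ⁆)
      RankRises-lower {i} i≤p = +-cancelˡ-≤ ⟦ p ⟧ (begin
        ⟦ p ⟧ + ⟦ suc i ⟧                   ≡⟨ ⟦suc⟧-exchange p i ⟨
        ⟦ suc p ⟧ + ⟦ i ⟧                   ≤⟨ +-mono-≤ rank-φp∪y (≤ᵍ-reflexive (sym ρ-Ai)) ⟩
        ρ (φ (take p ω) ∪ ⁅ y ⁆) + ρ (A i)  ≤⟨ diminishing-returns y Ai⊆φp ⟩
        ρ (φ (take p ω)) + ρ (A i ∪ ⁅ y ⁆)  ≡⟨ cong (_+ _) (rank-φ-take p≤n) ⟩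
        ⟦ p ⟧ + ρ (A i ∪ ⁅ y ⁆)             ∎)
        where
        ρ-Ai : ρ (A i) ≡ ⟦ i ⟧
        ρ-Ai = rank-take (≤-trans i≤p p≤n)
        Ai⊆φp : A i ⊆ φ (take p ω)
        Ai⊆φp = ⊆-trans (letters-take-mono ω i≤p) (letters-⊆ _ (Λ-take p Λω))

      RankRises-p : RankRises p
      RankRises-p = antisym
        (begin
          ρ (A p ∪ ⁅ y ⁆)         ≤⟨ monotone _ _ (∪-lub Ap⊆φ1+p (⁅x⁆⊆ y∈φ1+p)) ⟩
          ρ (φ (take (suc p) ω))  ≡⟨ rank-φ-take 1+p≤n ⟩
          ⟦ suc p ⟧               ∎)
        (RankRises-lower ≤-refl)
        where
        Ap⊆φ1+p : A p ⊆ φ (take (suc p) ω)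
        Ap⊆φ1+p = ⊆-trans (letters-⊆ _ (Λ-take p Λω)) (φ-take-mono Λω (n≤1+n p) 1+p≤n)

      RankRises-upward : ∀ {i j} → j ≤ i → i ≤ p → RankRises j → RankRises i
      RankRises-upward j≤i i≤p rises-j =
        antisym (RankRises-upper j≤i (≤-trans i≤p p≤n) rises-j) (RankRises-lower i≤p)

      ¬Γ-beyond : ∀ {i} → p < i → i ≤ length ω → ¬ Γ Λ (take i ω) y
      ¬Γ-beyond {i} p<i i≤n = ∈φ⇒¬Γ (Λ-take i Λω) (φ-take-mono Λω p<i i≤n y∈φ1+p)

      Γ-interval : Σ ℕ λ j → Σ ℕ λ k → j < k × k ≤ length ω ×
                   (∀ i → i ≤ length ω → ((j ≤ i × i < k) ⇔ Γ Λ (take i ω) y))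
      Γ-interval with least rankRises? RankRises-p
      ... | j , j≤p , rises-j , below-j = j , suc p , s≤s j≤p , 1+p≤n , λ i i≤n → mk⇔
        (λ (j≤i , i<1+p) → from (Γ⇔RankRises i≤n) (RankRises-upward j≤i (s≤s⁻¹ i<1+p) rises-j))
        (λ Γi → ≮⇒≥ (λ i<j → below-j i i<j (to (Γ⇔RankRises i≤n) Γi))
              , s≤s (≮⇒≥ λ p<i → ¬Γ-beyond p<i i≤n Γi))

mainTheorem5 : (n : ℕ) (Λ : Language {n}) → IsGreedoid Λ → IsNormal Λ →
    (G : OrderedAbelianGroup) → AlignedPolymatroidRep G Λ →
    (ω : Word {n}) → IsBasic Λ ω →
    (y : Fin n) →
      Σ ℕ λ j → Σ ℕ λ k → j < k × k ≤ length ω ×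
        (∀ i → i ≤ length ω → ((j ≤ i × i < k) ⇔ Γ Λ (take i ω) y))
mainTheorem5 n Λ gr normal G R ω ω-basic y =
  let open AlignedRepresentationProperties gr G R
      p , 1+p≤n , y∉φp , y∈φ1+p = first-flat-containing normal ω-basic y
  in Γ-interval (proj₁ ω-basic) y 1+p≤n y∉φp y∈φ1+p
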